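{- Every function symbol is computable.
   Context: Simply typed terms: there is a single base type (sort) $\iota$; types are $\iota$ and $\sigma \Rightarrow \tau$. Given a set of typed variables (infinitely many of each type) and a possibly infinite set of typed function symbols, terms are built from variables and function symbols by type-respecting application: if $s :: \sigma \Rightarrow \tau$ and $t :: \sigma$ then $s\ t :: \tau$ (left-associative). Every term has the form $a\ s_1 \cdots s_n$ ($n\ge 0$) with $a$ a variable or function symbol. Fixed data: a precedence $\unrhd$ (a quasi-ordering on function symbols whose strict part $\rhd$ is well-founded; $\equiv$ denotes $\unrhd \cap \unlhd$), and a filter $\pi$ assigning to each $\mathsf{f} :: \sigma_1 \Rightarrow \dots \Rightarrow \sigma_m \Rightarrow \iota$ a set $\pi(\mathsf{f}) \subseteq \{1,\dots,m\}$; for each $\mathsf{f}$ the arities of the symbols $\mathsf{g} \equiv \mathsf{f}$ are bounded. Equivalence: $s \approx t$ iff $s,t$ have the same type and either (Eq-mono) $s = x\ s_1 \cdots s_n$, $t = x\ t_1 \cdots t_n$, $x$ a variable, $s_i \approx t_i$ for all $i$; or (Eq-args) $s = \mathsf{f}\ s_1 \cdots s_n$, $t = \mathsf{g}\ t_1 \cdots t_n$, $\mathsf{f},\mathsf{g}$ function symbols of the same type, $\mathsf{f} \equiv \mathsf{g}$, $\pi(\mathsf{f}) = \pi(\mathsf{g})$, $s_i \approx t_i$ for all $i \in \pi(\mathsf{f}) \cap \{1,\dots,n\}$. The relations $\sqsupseteq, \sqsupset, \sqsupset\!\!\sqsupset$ are the least relations such that: $s \sqsupseteq t$ iff $s \approx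 t$ or $s \sqsupset t$. $s \sqsupset t$ if $s,t$ have the same type and one of: (Gr-mono) $s = x\ s_1 \cdots s_n$, $t = x\ t_1 \cdots t_n$, $x$ a variable, $s_i \sqsupseteq t_i$ for all $i$ and $s_i \sqsupset t_i$ for some $i$; (Gr-args) $s = \mathsf{f}\ s_1 \cdots s_n$, $t = \mathsf{g}\ t_1 \cdots t_n$, $\mathsf{f},\mathsf{g}$ of the same type, $\mathsf{f} \equiv \mathsf{g}$, $\pi(\mathsf{f}) = \pi(\mathsf{g})$, $s_i \sqsupseteq t_i$ for all $i \in \pi(\mathsf{f}) \cap \{1,\dots,n\}$ and $s_i \sqsupset t_i$ for some such $i$; (Gr-rpo) $s \sqsupset\!\!\sqsupset t$. $s \sqsupset\!\!\sqsupset t$ ($s,t$ possibly of different types) if $s = \mathsf{f}\ s_1 \cdots s_n$ with $\mathsf{f} :: \sigma_1 \Rightarrow \dots \Rightarrow \sigma_m \Rightarrow \iota$, $\{n+1,\dots,m\} \subseteq \pi(\mathsf{f})$, and one of: (Rpo-select) $s_i \sqsupseteq t$ for some $i \in \pi(\mathsf{f}) \cap \{1,\dots,n\}$; (Rpo-appl) $t = t_0\ t_1 \cdots t_k$ with $k \ge 1$ and $s \sqsupset\!\!\sqsupset t_i$ for all $0 \le i \le k$; (Rpo-copy) $t = \mathsf{g}\ t_1 \cdots t_k$ with $\mathsf{f} \rhd \mathsf{g}$ and $s \sqsupset\!\!\sqsupset t_i$ for all $i \in \pi(\mathsf{g}) \cap \{1,\dots,k\}$; (Rpo-lex) $t = \mathsf{g}\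 t_1 \cdots t_k$ with $\mathsf{f} \equiv \mathsf{g}$ and there is $i \in \pi(\mathsf{f}) \cap \pi(\mathsf{g}) \cap \{1,\dots,\min(n,k)\}$ with $\pi(\mathsf{f}) \cap \{1,\dots,i\} = \pi(\mathsf{g}) \cap \{1,\dots,i\}$, $s_j \approx t_j$ for all $j \in \{1,\dots,i-1\} \cap \pi(\mathsf{f})$, $s_i \sqsupset t_i$, and $s \sqsupset\!\!\sqsupset t_j$ for all $j \in \{i+1,\dots,k\} \cap \pi(\mathsf{g})$. A term $s$ is terminating if there is no infinite sequence $s \sqsupset s_1 \sqsupset s_2 \sqsupset \cdots$. By induction on types: a term $s :: \sigma_1 \Rightarrow \dots \Rightarrow \sigma_m \Rightarrow \iota$ is computable if for all computable $t_1 :: \sigma_1, \dots, t_m :: \sigma_m$ the term $s\ t_1 \cdots t_m$ is terminating; a function symbol is computable if it is computable as a term. -}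

module Defs where

open import Data.Nat using (ℕ; zero; suc; _≤_; _<_)
open import Data.Bool using (Bool; true; false)
open import Data.Fin using (Fin; toℕ)
open import Data.Vec using (Vec; lookup; foldl)
open import Data.Product using (Σ; ∃; ∃-syntax; _×_; _,_)
open import Data.Sum using (_⊎_)
open import Relation.Nullary using (¬_)
open import Relation.Binary.PropositionalEquality using (_≡_)
open import Relation.Binary.Structures using (IsPreorder)
open import Induction.WellFounded using (WellFounded; Acc)

infixr 5 _⇒_
data Ty : Set where
  ι   : Ty
  _⇒_ : Ty → Ty → Ty

arity : Ty → ℕ
arity ι       = 0
arity (σ ⇒ τ) = suc (arity τ)

record Setting : Set₁ where
  field
    Fun  : Set
    type : Fun → Ty
    _⊵_          : Fun → Fun → Set
    ⊵-isPreorder : IsPreorder _≡_ _⊵_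
    -- the filter π(f) ⊆ {1,…,m}, positions are 1-based
    π       : Fun → ℕ → Bool
    π-range : ∀ f i → π f i ≡ true → (1 ≤ i) × (i ≤ arity (type f))

  _▷_ : Fun → Fun → Set
  f ▷ g = (f ⊵ g) × ¬ (g ⊵ f)

  _≡ₚ_ : Fun → Fun → Set
  f ≡ₚ g = (f ⊵ g) × (g ⊵ f)

  field
    ▷-wf : WellFounded (λ g f → f ▷ g)
    ≡ₚ-bounded : ∀ f → ∃[ N ] (∀ g → g ≡ₚ f → arity (type g) ≤ N)

module Theory (S : Setting) where
  open Setting S

  infixl 9 _·_
  data Tm : Set where
    var : Ty → ℕ → Tm
    fun : Fun → Tm
    _·_ : Tm → Tm → Tm

  apps : ∀ {n} → Tm → Vec Tm n → Tm
  apps a ss = foldl (λ _ → Tm) _·_ a ss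

  data _∶_ : Tm → Ty → Set where
    ty-var : ∀ {σ x} → var σ x ∶ σ
    ty-fun : ∀ {f} → fun f ∶ type f
    ty-app : ∀ {s t σ τ} → s ∶ (σ ⇒ τ) → t ∶ σ → (s · t) ∶ τ

  Typed : Tm → Set
  Typed t = ∃[ σ ] (t ∶ σ)

  -- i-th argument (i : Fin n is the 0-based index, position suc (toℕ i))
  inπ : Fun → ∀ {n} → Fin n → Set
  inπ f i = π f (suc (toℕ i)) ≡ true

  data _≈_ : Tm → Tm → Set where
    eq-mono : ∀ {s t σ ρ x n} (ss ts : Vec Tm n) →
      s ∶ σ → t ∶ σ →
      s ≡ apps (var ρ x) ss → t ≡ apps (var ρ x) ts →
      (∀ i → lookup ss i ≈ lookup ts i) →
      s ≈ t
    eq-args : ∀ {s t σ n} (f g : Fun) (ss ts : Vec Tm n) →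
      s ∶ σ → t ∶ σ →
      s ≡ apps (fun f) ss → t ≡ apps (fun g) ts →
      type f ≡ type g → f ≡ₚ g → (∀ j → π f j ≡ π g j) →
      (∀ i → inπ f i → lookup ss i ≈ lookup ts i) →
      s ≈ t

  mutual
    data _⊒_ : Tm → Tm → Set where
      ⊒-≈ : ∀ {s t} → s ≈ t → s ⊒ t
      ⊒-⊐ : ∀ {s t} → s ⊐ t → s ⊒ t

    data _⊐_ : Tm → Tm → Set where
      gr-mono : ∀ {s t σ ρ x n} (ss ts : Vec Tm n) →
        s ∶ σ → t ∶ σ →
        s ≡ apps (var ρ x) ss → t ≡ apps (var ρ x) ts →
        (∀ i → lookup ss i ⊒ lookup ts i) →
        (∃[ i ] (lookup ss i ⊐ lookup ts i)) →
        s ⊐ t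
      gr-args : ∀ {s t σ n} (f g : Fun) (ss ts : Vec Tm n) →
        s ∶ σ → t ∶ σ →
        s ≡ apps (fun f) ss → t ≡ apps (fun g) ts →
        type f ≡ type g → f ≡ₚ g → (∀ j → π f j ≡ π g j) →
        (∀ i → inπ f i → lookup ss i ⊒ lookup ts i) →
        (∃[ i ] (inπ f i × (lookup ss i ⊐ lookup ts i))) →
        s ⊐ t
      gr-rpo : ∀ {s t σ} →
        s ∶ σ → t ∶ σ →
        s ⊐⊐ t →
        s ⊐ t

    -- ⊐⊐ (s, t terms, possibly of different types).
    -- Each rule has the common side condition: s = f s₁ ⋯ sₙ with
    -- {n+1,…,m} ⊆ π(f), where m is the arity of f.
    data _⊐⊐_ : Tm → Tm → Set where
      rpo-select : ∀ {s t n} (f : Fun) (ss : Vec Tm n) →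
        Typed s → Typed t → s ≡ apps (fun f) ss →
        (∀ j → n < j → j ≤ arity (type f) → π f j ≡ true) →
        (∃[ i ] (inπ f i × (lookup ss i ⊒ t))) →
        s ⊐⊐ t
      rpo-appl : ∀ {s t n k} (f : Fun) (ss : Vec Tm n) (t₀ : Tm) (ts : Vec Tm (suc k)) →
        Typed s → Typed t → s ≡ apps (fun f) ss →
        (∀ j → n < j → j ≤ arity (type f) → π f j ≡ true) →
        t ≡ apps t₀ ts →
        s ⊐⊐ t₀ → (∀ i → s ⊐⊐ lookup ts i) →
        s ⊐⊐ t
      rpo-copy : ∀ {s t n k} (f : Fun) (ss : Vec Tm n) (g : Fun) (ts : Vec Tm k) →
        Typed s → Typed t → s ≡ apps (fun f) ss →
        (∀ j → n < j → j ≤ arity (type f) → π f j ≡ true) →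
        t ≡ apps (fun g) ts → f ▷ g →
        (∀ i → inπ g i → s ⊐⊐ lookup ts i) →
        s ⊐⊐ t
      -- the chosen position is i (in ss) = i' (in ts), so i ≤ min(n,k)
      rpo-lex : ∀ {s t n k} (f : Fun) (ss : Vec Tm n) (g : Fun) (ts : Vec Tm k) →
        Typed s → Typed t → s ≡ apps (fun f) ss →
        (∀ j → n < j → j ≤ arity (type f) → π f j ≡ true) →
        t ≡ apps (fun g) ts → f ≡ₚ g →
        (i : Fin n) (i' : Fin k) → toℕ i ≡ toℕ i' →
        inπ f i → inπ g i' →
        (∀ j → j ≤ suc (toℕ i) → π f j ≡ π g j) →
        (∀ (j : Fin n) (j' : Fin k) → toℕ j ≡ toℕ j' → toℕ j < toℕ i →
           inπ f j → lookup ss j ≈ lookup ts j') →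
        lookup ss i ⊐ lookup ts i' →
        (∀ (j : Fin k) → toℕ i' < toℕ j → inπ g j → s ⊐⊐ lookup ts j) →
        s ⊐⊐ t

  -- termination: accessibility for the reverse of ⊐
  -- (no infinite chain s ⊐ s₁ ⊐ s₂ ⊐ ⋯, read constructively)
  Terminating : Tm → Set
  Terminating = Acc (λ t s → s ⊐ t)

  -- computability, by induction on the type; for σ = σ₁ ⇒ … ⇒ σₘ ⇒ ι
  -- this unfolds to: for all computable tᵢ ∶ σᵢ, s t₁ ⋯ tₘ is terminating
  Computable : Ty → Tm → Set
  Computable ι       s = Terminating s
  Computable (σ ⇒ τ) s = ∀ t → t ∶ σ → Computable σ t → Computable τ (s · t)

  ComputableFun : Fun → Set
  ComputableFun f = Computable (type f) (fun f)

{-# OPTIONS --safe #-}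
module Submission where

-- Tait–Girard computability. Computable terms terminate, because a fresh variable is
-- computable; computability is closed under ⊒; and a variable applied to terminating
-- arguments is computable, by lexicographic induction on the arguments. The heart of the
-- proof is that f s₁ ⋯ sₙ of base type terminates whenever its filtered arguments are
-- computable. This goes by well-founded induction on f along ▷ and, within the ≡ₚ-class
-- of f, on the lexicographic extension of ⊐ to the filtered argument vectors. A Gr-args
-- step decreases that vector. For Gr-rpo, every ⊐⊐-reduct is computable by induction on
-- the ⊐⊐-derivation: Rpo-copy uses the ▷-hypothesis and Rpo-lex the lexicographic one.

open import Data.Bool using (Bool; true; false; if_then_else_)
open import Data.Empty using (⊥-elim)
open import Data.Fin using (Fin; zero; suc; toℕ; inject₁; fromℕ)
open import Data.Fin.Properties using (toℕ-inject₁; toℕ-fromℕ; toℕ<n; toℕ-injective)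
import Data.List as List
open import Data.List.Properties using (∷-injective; ++-identityʳ)
open import Data.Nat using (ℕ; zero; suc; _+_; _≤_; _<_; z≤n; s≤s)
open import Data.Nat.Properties using (+-identityʳ; +-suc; m≤m+n; <-trans; n<1+n; <⇒≤; <-≤-trans; <-cmp)
open import Data.Product using (Σ; _×_; _,_; proj₁; proj₂)
open import Data.Sum using (_⊎_; inj₁; inj₂)
open import Data.Unit using (⊤; tt)
open import Data.Vec using (Vec; []; _∷_; lookup; _∷ʳ_; _++_; toList; tabulate)
open import Data.Vec.Properties using (foldl-∷ʳ)
open import Data.Vec.Relation.Binary.Lex.Strict using (Lex-<; <-wellFounded; this; next)
open import Function using (_∘_)
open import Induction.WellFounded using (Acc; acc; WellFounded)
open import Relation.Binary.Definitions using (tri<; tri≈; tri>)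
open import Relation.Binary.PropositionalEquality
open import Relation.Binary.Structures using (IsPreorder)
open import Relation.Nullary using (¬_)

open import Defs

private
  variable
    A : Set
    n k : ℕ

module _ {_≈_ _≺_ : A → A → Set} where

  tabulate-Lex-<-pointwise : ∀ N (x y : ℕ → A) → (∀ q → x q ≈ y q ⊎ x q ≺ y q) →
    ∀ p → p < N → x p ≺ y p → Lex-< _≈_ _≺_ (tabulate {n = N} (x ∘ toℕ)) (tabulate {n = N} (y ∘ toℕ))
  tabulate-Lex-<-pointwise (suc N) x y cmp zero    _         x≺y = this x≺y refl
  tabulate-Lex-<-pointwise (suc N) x y cmp (suc p) (s≤s p<N) x≺y with cmp 0
  ... | inj₂ x₀≺y₀ = this x₀≺y₀ refl
  ... | inj₁ x₀≈y₀ =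
    next x₀≈y₀ (tabulate-Lex-<-pointwise N (x ∘ suc) (y ∘ suc) (cmp ∘ suc) p p<N x≺y)

  tabulate-Lex-<-prefix : ∀ N (x y : ℕ → A) p → p < N → (∀ q → q < p → x q ≈ y q) →
    x p ≺ y p → Lex-< _≈_ _≺_ (tabulate {n = N} (x ∘ toℕ)) (tabulate {n = N} (y ∘ toℕ))
  tabulate-Lex-<-prefix (suc N) x y zero    _         _   x≺y = this x≺y refl
  tabulate-Lex-<-prefix (suc N) x y (suc p) (s≤s p<N) eqs x≺y =
    next (eqs 0 (s≤s z≤n))
      (tabulate-Lex-<-prefix N (x ∘ suc) (y ∘ suc) p p<N (λ q q<p → eqs (suc q) (s≤s q<p)) x≺y)

if-rel : (R : A → A → Set) {b c : Bool} {x y d : A} → b ≡ c → R d d → (b ≡ true → R x y) →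
         R (if b then x else d) (if c then y else d)
if-rel R {true}  refl _   xRy = xRy refl
if-rel R {false} refl dRd _   = dRd

if-all : (P : A → Set) {b : Bool} {x d : A} → P d → (b ≡ true → P x) → P (if b then x else d)
if-all P {true}  _  Px = Px refl
if-all P {false} Pd _  = Pd

lookup-∷ʳ-inject₁ : (xs : Vec A n) (y : A) (i : Fin n) → lookup (xs ∷ʳ y) (inject₁ i) ≡ lookup xs i
lookup-∷ʳ-inject₁ (x ∷ xs) y zero    = refl
lookup-∷ʳ-inject₁ (x ∷ xs) y (suc i) = lookup-∷ʳ-inject₁ xs y i

lookup-∷ʳ-fromℕ : (xs : Vec A n) (y : A) → lookup (xs ∷ʳ y) (fromℕ n) ≡ y
lookup-∷ʳ-fromℕ []       y = refl
lookup-∷ʳ-fromℕ (x ∷ xs) y = lookup-∷ʳ-fromℕ xs y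

∷ʳ-pointwise-on : (R : A → A → Set) {P : ℕ → Set} (xs ys : Vec A n) (z : A) →
  (∀ i → P (toℕ i) → R (lookup xs i) (lookup ys i)) → (P n → R z z) →
  ∀ i → P (toℕ i) → R (lookup (xs ∷ʳ z) i) (lookup (ys ∷ʳ z) i)
∷ʳ-pointwise-on R []       []       z _   zRz zero    = zRz
∷ʳ-pointwise-on R (x ∷ xs) (y ∷ ys) z xRy _   zero    = xRy zero
∷ʳ-pointwise-on R {P} (x ∷ xs) (y ∷ ys) z xRy zRz (suc i) =
  ∷ʳ-pointwise-on R {P ∘ suc} xs ys z (xRy ∘ suc) zRz i

∷ʳ-pointwise : (R : A → A → Set) (xs ys : Vec A n) (z : A) →
  (∀ i → R (lookup xs i) (lookup ys i)) → R z z → ∀ i → R (lookup (xs ∷ʳ z) i) (lookup (ys ∷ʳ z) i)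
∷ʳ-pointwise R xs ys z xRy zRz i = ∷ʳ-pointwise-on R {λ _ → ⊤} xs ys z (λ i _ → xRy i) (λ _ → zRz) i tt

∷ʳ-prefix : {P : ℕ → A → Set} (xs : Vec A n) (z : A) (i : Fin n) →
  (∀ (j : Fin n) → toℕ j < toℕ i → P (toℕ j) (lookup xs j)) →
  ∀ (j : Fin (suc n)) → toℕ j < toℕ (inject₁ i) → P (toℕ j) (lookup (xs ∷ʳ z) j)
∷ʳ-prefix (x ∷ xs) z (suc i) Pxs zero    _         = Pxs zero (s≤s z≤n)
∷ʳ-prefix {P = P} (x ∷ xs) z (suc i) Pxs (suc j) (s≤s j<i) =
  ∷ʳ-prefix {P = P ∘ suc} xs z i (λ j j<i → Pxs (suc j) (s≤s j<i)) j j<i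

++-all : (P : A → Set) {Q : ℕ → Set} (xs : Vec A n) (ys : Vec A k) →
  (∀ i → Q (toℕ i) → P (lookup xs i)) → (∀ j → P (lookup ys j)) →
  ∀ i → Q (toℕ i) → P (lookup (xs ++ ys) i)
++-all P []       ys _   Pys i       _ = Pys i
++-all P (x ∷ xs) ys Pxs _   zero    q = Pxs zero q
++-all P {Q} (x ∷ xs) ys Pxs Pys (suc i) q = ++-all P {Q ∘ suc} xs ys (Pxs ∘ suc) Pys i q

lookupOr : A → Vec A n → ℕ → A
lookupOr d []       _       = d
lookupOr d (x ∷ xs) zero    = x
lookupOr d (x ∷ xs) (suc p) = lookupOr d xs p

module _ {d : A} where

  lookupOr-lookup : (xs : Vec A n) (i : Fin n) → lookupOr d xs (toℕ i) ≡ lookup xs i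
  lookupOr-lookup (x ∷ xs) zero    = refl
  lookupOr-lookup (x ∷ xs) (suc i) = lookupOr-lookup xs i

  lookupOr-++ˡ : (xs : Vec A n) (ys : Vec A k) (p : ℕ) → p < n → lookupOr d (xs ++ ys) p ≡ lookupOr d xs p
  lookupOr-++ˡ (x ∷ xs) ys zero    _         = refl
  lookupOr-++ˡ (x ∷ xs) ys (suc p) (s≤s p<n) = lookupOr-++ˡ xs ys p p<n

  lookupOr-all : (P : A → Set) {Q : ℕ → Set} (xs : Vec A n) → P d →
    (∀ i → Q (toℕ i) → P (lookup xs i)) → ∀ p → Q p → P (lookupOr d xs p)
  lookupOr-all P []       Pd _   _       _ = Pd
  lookupOr-all P (x ∷ xs) Pd Pxs zero    q = Pxs zero q
  lookupOr-all P {Q} (x ∷ xs) Pd Pxs (suc p) q = lookupOr-all P {Q ∘ suc} xs Pd (Pxs ∘ suc) p q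

  lookupOr-pointwise : (R : A → A → Set) {Q : ℕ → Set} (xs ys : Vec A n) → R d d →
    (∀ i → Q (toℕ i) → R (lookup xs i) (lookup ys i)) → ∀ p → Q p → R (lookupOr d xs p) (lookupOr d ys p)
  lookupOr-pointwise R []       []       dRd _   _       _ = dRd
  lookupOr-pointwise R (x ∷ xs) (y ∷ ys) dRd xRy zero    q = xRy zero q
  lookupOr-pointwise R {Q} (x ∷ xs) (y ∷ ys) dRd xRy (suc p) q =
    lookupOr-pointwise R {Q ∘ suc} xs ys dRd (xRy ∘ suc) p q

  lookupOr-aligned : (R : A → A → Set) {Q : ℕ → Set} (xs : Vec A n) (ys : Vec A k) →
    (∀ i j → toℕ i ≡ toℕ j → Q (toℕ i) → R (lookup xs i) (lookup ys j)) →
    ∀ p → p < n → p < k → Q p → R (lookupOr d xs p) (lookupOr d ys p)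
  lookupOr-aligned R (x ∷ xs) (y ∷ ys) xRy zero    _         _         q = xRy zero zero refl q
  lookupOr-aligned R {Q} (x ∷ xs) (y ∷ ys) xRy (suc p) (s≤s p<n) (s≤s p<k) q =
    lookupOr-aligned R {Q ∘ suc} xs ys (λ i j i≡j → xRy (suc i) (suc j) (cong suc i≡j)) p p<n p<k q

module Computability (S : Setting) where
  open Setting S
  open Theory S
  private
    module ⊵ = IsPreorder ⊵-isPreorder
    variable
      f g h : Fun
      a b s t u : Tm
      σ τ : Ty

  data Atom : Tm → Set where
    var : ∀ {ρ x} → Atom (var ρ x)
    fun : Atom (fun f)

  spine : Tm → List.List Tm → Tm × List.List Tm
  spine (s · t) ts = spine s (t List.∷ ts)
  spine a       ts = a , ts

  spine-apps : ∀ b (ss : Vec Tm n) ts → spine (apps b ss) ts ≡ spine b (toList ss List.++ ts)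
  spine-apps b []       ts = refl
  spine-apps b (s ∷ ss) ts = spine-apps (b · s) ss ts

  spine-atom-apps : Atom a → (ss : Vec Tm n) → spine (apps a ss) List.[] ≡ (a , toList ss)
  spine-atom-apps {a} A ss = begin
    spine (apps a ss) List.[]      ≡⟨ spine-apps a ss List.[] ⟩
    spine a (toList ss List.++ List.[]) ≡⟨ spine-atom A ⟩
    (a , toList ss List.++ List.[]) ≡⟨ cong (a ,_) (++-identityʳ (toList ss)) ⟩
    (a , toList ss)                ∎
    where
    open ≡-Reasoning
    spine-atom : Atom a → ∀ {ts} → spine a ts ≡ (a , ts)
    spine-atom var = refl
    spine-atom fun = refl

  _≡ᵛ_ : Vec Tm n → Vec Tm k → Set
  ss ≡ᵛ ts = _≡_ {A = Σ ℕ (Vec Tm)} (_ , ss) (_ , ts)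

  toList-injective′ : (ss : Vec Tm n) (ts : Vec Tm k) → toList ss ≡ toList ts → ss ≡ᵛ ts
  toList-injective′ []       []       _ = refl
  toList-injective′ (s ∷ ss) (t ∷ ts) e with ∷-injective e
  ... | refl , e′ with toList-injective′ ss ts e′
  ... | refl = refl

  apps-injective : Atom a → Atom b → (ss : Vec Tm n) (ts : Vec Tm k) → apps a ss ≡ apps b ts →
                   a ≡ b × ss ≡ᵛ ts
  apps-injective {a = a} {b = b} A B ss ts e = cong proj₁ spines≡ , toList-injective′ ss ts (cong proj₂ spines≡)
    where
    spines≡ : (a , toList ss) ≡ (b , toList ts)
    spines≡ = trans (sym (spine-atom-apps A ss)) (trans (cong (λ t → spine t List.[]) e) (spine-atom-apps B ts))

  var≢fun : ∀ {ρ x} (ss : Vec Tm n) (ts : Vec Tm k) → apps (var ρ x) ss ≢ apps (fun f) ts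
  var≢fun ss ts e with apps-injective var fun ss ts e
  ... | () , _

  apps-∷ʳ : ∀ a (ss : Vec Tm n) u → apps a (ss ∷ʳ u) ≡ apps a ss · u
  apps-∷ʳ a ss u = foldl-∷ʳ (λ _ → Tm) _·_ a u ss

  apps-++ : ∀ a (ss : Vec Tm n) (us : Vec Tm k) → apps a (ss ++ us) ≡ apps (apps a ss) us
  apps-++ a []       us = refl
  apps-++ a (s ∷ ss) us = apps-++ (a · s) ss us

  ∶-unique : s ∶ σ → s ∶ τ → σ ≡ τ
  ∶-unique ty-var ty-var = refl
  ∶-unique ty-fun ty-fun = refl
  ∶-unique (ty-app s∶ _) (ty-app s∶′ _) with ∶-unique s∶ s∶′
  ... | refl = refl

  apps-head-typed : ∀ a (ss : Vec Tm n) → apps a ss ∶ τ → Typed a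
  apps-head-typed a []       a∶ = _ , a∶
  apps-head-typed a (s ∷ ss) d  with apps-head-typed (a · s) ss d
  ... | _ , ty-app a∶ _ = _ , a∶

  apps-arity : ∀ a (ss : Vec Tm n) → a ∶ σ → apps a ss ∶ τ → arity σ ≡ n + arity τ
  apps-arity a []       a∶ d rewrite ∶-unique a∶ d = refl
  apps-arity a (s ∷ ss) a∶ d with apps-head-typed (a · s) ss d
  ... | _ , ty-app a∶′ s∶ with ∶-unique a∶ a∶′
  ... | refl = cong suc (apps-arity (a · s) ss (ty-app a∶′ s∶) d)

  fun-apps-ι-arity : (ss : Vec Tm n) → apps (fun f) ss ∶ ι → arity (type f) ≡ n
  fun-apps-ι-arity {n} ss d = trans (apps-arity _ ss ty-fun d) (+-identityʳ n)

  fun-apps-⇒-arity : (ss : Vec Tm n) → apps (fun f) ss ∶ (σ ⇒ τ) → suc n ≤ arity (type f)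
  fun-apps-⇒-arity {n} {τ = τ} ss d rewrite apps-arity _ ss ty-fun d | +-suc n (arity τ) =
    s≤s (m≤m+n n (arity τ))

  ≡ₚ-refl : f ≡ₚ f
  ≡ₚ-refl = ⊵.refl , ⊵.refl

  ≡ₚ-sym : f ≡ₚ g → g ≡ₚ f
  ≡ₚ-sym (f⊵g , g⊵f) = g⊵f , f⊵g

  ≡ₚ-trans : f ≡ₚ g → g ≡ₚ h → f ≡ₚ h
  ≡ₚ-trans (f⊵g , g⊵f) (g⊵h , h⊵g) = ⊵.trans f⊵g g⊵h , ⊵.trans h⊵g g⊵f

  ≡ₚ-▷-trans : f ≡ₚ g → g ▷ h → f ▷ h
  ≡ₚ-▷-trans (f⊵g , _) (g⊵h , h⋬g) = ⊵.trans f⊵g g⊵h , λ h⊵f → h⋬g (⊵.trans h⊵f f⊵g)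

  TailFiltered : Fun → ℕ → Set
  TailFiltered f n = ∀ j → n < j → j ≤ arity (type f) → π f j ≡ true

  TailFiltered-suc : TailFiltered f n → TailFiltered f (suc n)
  TailFiltered-suc tail j n+1<j = tail j (<-trans (n<1+n _) n+1<j)

  TailFiltered-resp : type f ≡ type g → (∀ j → π f j ≡ π g j) → TailFiltered g n → TailFiltered f n
  TailFiltered-resp f≡g πf≡πg tail j n<j j≤m =
    trans (πf≡πg j) (tail j n<j (subst (λ σ → j ≤ arity σ) f≡g j≤m))

  ⊐⊐-typedʳ : s ⊐⊐ t → Typed t
  ⊐⊐-typedʳ (rpo-select _ _ _ t∶ _ _ _)                     = t∶
  ⊐⊐-typedʳ (rpo-appl _ _ _ _ _ t∶ _ _ _ _ _)               = t∶
  ⊐⊐-typedʳ (rpo-copy _ _ _ _ _ t∶ _ _ _ _ _)               = t∶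
  ⊐⊐-typedʳ (rpo-lex _ _ _ _ _ t∶ _ _ _ _ _ _ _ _ _ _ _ _ _) = t∶

  ⊐⊐-fun-head : s ⊐⊐ t →
                Σ Fun λ f → Σ ℕ λ n → Σ (Vec Tm n) λ ss → s ≡ apps (fun f) ss × TailFiltered f n
  ⊐⊐-fun-head (rpo-select f ss _ _ e tail _)                     = f , _ , ss , e , tail
  ⊐⊐-fun-head (rpo-appl f ss _ _ _ _ e tail _ _ _)               = f , _ , ss , e , tail
  ⊐⊐-fun-head (rpo-copy f ss _ _ _ _ e tail _ _ _)               = f , _ , ss , e , tail
  ⊐⊐-fun-head (rpo-lex f ss _ _ _ _ e tail _ _ _ _ _ _ _ _ _ _ _) = f , _ , ss , e , tail

  ⊐⊐-var-head : ∀ {ρ x} (ss : Vec Tm n) → ¬ (apps (var ρ x) ss ⊐⊐ t)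
  ⊐⊐-var-head ss r with ⊐⊐-fun-head r
  ... | _ , _ , ts , e , _ = var≢fun ss ts e

  ·-congˡ-≈ : s ≈ t → u ≈ u → (s · u) ∶ σ → (s · u) ≈ (t · u)
  ·-congˡ-≈ {u = u} (eq-mono ss ts s∶ t∶ refl refl ss≈ts) u≈u d@(ty-app s∶′ u∶)
    rewrite ∶-unique s∶ s∶′ =
    eq-mono (ss ∷ʳ u) (ts ∷ʳ u) d (ty-app t∶ u∶) (sym (apps-∷ʳ _ ss u)) (sym (apps-∷ʳ _ ts u))
      (∷ʳ-pointwise _≈_ ss ts u ss≈ts u≈u)
  ·-congˡ-≈ {u = u} (eq-args f g ss ts s∶ t∶ refl refl tyf≡tyg f≡ₚg πf≡πg ss≈ts) u≈u
            d@(ty-app s∶′ u∶) rewrite ∶-unique s∶ s∶′ =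
    eq-args f g (ss ∷ʳ u) (ts ∷ʳ u) d (ty-app t∶ u∶) (sym (apps-∷ʳ _ ss u)) (sym (apps-∷ʳ _ ts u))
      tyf≡tyg f≡ₚg πf≡πg
      (∷ʳ-pointwise-on _≈_ {λ p → π f (suc p) ≡ true} ss ts u ss≈ts (λ _ → u≈u))

  ≈-refl : s ∶ σ → s ≈ s
  ≈-refl ty-var          = eq-mono [] [] ty-var ty-var refl refl λ ()
  ≈-refl ty-fun          = eq-args _ _ [] [] ty-fun ty-fun refl refl refl ≡ₚ-refl (λ _ → refl) λ ()
  ≈-refl (ty-app s∶ u∶) = ·-congˡ-≈ (≈-refl s∶) (≈-refl u∶) (ty-app s∶ u∶)

  ≈-∶ : s ≈ t → s ∶ σ → t ∶ σ
  ≈-∶ (eq-mono _ _ s∶ t∶ _ _ _)           s∶′ rewrite ∶-unique s∶′ s∶ = t∶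
  ≈-∶ (eq-args _ _ _ _ s∶ t∶ _ _ _ _ _ _) s∶′ rewrite ∶-unique s∶′ s∶ = t∶

  ≈-typedˡ : s ≈ t → Typed s
  ≈-typedˡ (eq-mono _ _ s∶ _ _ _ _)           = _ , s∶
  ≈-typedˡ (eq-args _ _ _ _ s∶ _ _ _ _ _ _ _) = _ , s∶

  ≈-trans : s ≈ t → t ≈ u → s ≈ u
  ≈-trans (eq-mono ss ts s∶ t∶ refl refl ss≈ts) (eq-mono ts′ us t∶′ u∶ e refl ts≈us)
    with apps-injective var var ts ts′ e
  ... | refl , refl rewrite ∶-unique t∶ t∶′ =
    eq-mono ss us s∶ u∶ refl refl (λ i → ≈-trans (ss≈ts i) (ts≈us i))
  ≈-trans (eq-mono _ ts _ _ refl refl _) (eq-args _ _ ts′ _ _ _ e _ _ _ _ _) = ⊥-elim (var≢fun ts ts′ e)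
  ≈-trans (eq-args _ _ _ ts _ _ refl refl _ _ _ _) (eq-mono ts′ _ _ _ e _ _) = ⊥-elim (var≢fun ts′ ts (sym e))
  ≈-trans (eq-args f g ss ts s∶ t∶ refl refl tyf≡tyg f≡ₚg πf≡πg ss≈ts)
          (eq-args _ h ts′ us t∶′ u∶ e refl tyg≡tyh g≡ₚh πg≡πh ts≈us)
    with apps-injective fun fun ts ts′ e
  ... | refl , refl rewrite ∶-unique t∶ t∶′ =
    eq-args f h ss us s∶ u∶ refl refl (trans tyf≡tyg tyg≡tyh) (≡ₚ-trans f≡ₚg g≡ₚh)
      (λ j → trans (πf≡πg j) (πg≡πh j))
      (λ i πi → ≈-trans (ss≈ts i πi) (ts≈us i (trans (sym (πf≡πg _)) πi)))

  mutual
    ≈-⊒-trans : s ≈ t → t ⊒ u → s ⊒ u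
    ≈-⊒-trans s≈t (⊒-≈ t≈u) = ⊒-≈ (≈-trans s≈t t≈u)
    ≈-⊒-trans s≈t (⊒-⊐ t⊐u) = ⊒-⊐ (≈-⊐-trans s≈t t⊐u)

    ≈-⊐-trans : s ≈ t → t ⊐ u → s ⊐ u
    ≈-⊐-trans (eq-mono ss ts s∶ t∶ refl refl ss≈ts)
              (gr-mono ts′ us t∶′ u∶ e refl ts⊒us (i , tᵢ⊐uᵢ))
      with apps-injective var var ts ts′ e
    ... | refl , refl rewrite ∶-unique t∶ t∶′ =
      gr-mono ss us s∶ u∶ refl refl (λ i → ≈-⊒-trans (ss≈ts i) (ts⊒us i))
        (i , ≈-⊐-trans (ss≈ts i) tᵢ⊐uᵢ)
    ≈-⊐-trans (eq-mono _ ts _ _ refl refl _) (gr-args _ _ ts′ _ _ _ e _ _ _ _ _ _) = ⊥-elim (var≢fun ts ts′ e)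
    ≈-⊐-trans (eq-args _ _ _ ts _ _ refl refl _ _ _ _) (gr-mono ts′ _ _ _ e _ _ _) =
      ⊥-elim (var≢fun ts′ ts (sym e))
    ≈-⊐-trans (eq-args f g ss ts s∶ t∶ refl refl tyf≡tyg f≡ₚg πf≡πg ss≈ts)
              (gr-args _ h ts′ us t∶′ u∶ e refl tyg≡tyh g≡ₚh πg≡πh ts⊒us (i , πi , tᵢ⊐uᵢ))
      with apps-injective fun fun ts ts′ e
    ... | refl , refl rewrite ∶-unique t∶ t∶′ =
      gr-args f h ss us s∶ u∶ refl refl (trans tyf≡tyg tyg≡tyh) (≡ₚ-trans f≡ₚg g≡ₚh)
        (λ j → trans (πf≡πg j) (πg≡πh j))
        (λ i πi → ≈-⊒-trans (ss≈ts i πi) (ts⊒us i (trans (sym (πf≡πg _)) πi)))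
        (i , trans (πf≡πg _) πi , ≈-⊐-trans (ss≈ts i (trans (πf≡πg _) πi)) tᵢ⊐uᵢ)
    ≈-⊐-trans s≈t (gr-rpo t∶ u∶ t⊐⊐u) with ≈-typedˡ s≈t
    ... | _ , s∶ rewrite ∶-unique t∶ (≈-∶ s≈t s∶) = gr-rpo s∶ u∶ (≈-⊐⊐-trans s≈t t⊐⊐u)

    ≈-⊐⊐-trans : s ≈ t → t ⊐⊐ u → s ⊐⊐ u
    ≈-⊐⊐-trans (eq-mono _ ts _ _ _ refl _) t⊐⊐u = ⊥-elim (⊐⊐-var-head ts t⊐⊐u)
    ≈-⊐⊐-trans (eq-args f g ss ts s∶ _ refl refl tyf≡tyg _ πf≡πg ss≈ts)
               (rpo-select _ ts′ _ u∶ e tail (i , πi , tᵢ⊒u))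
      with apps-injective fun fun ts ts′ e
    ... | refl , refl =
      rpo-select f ss (_ , s∶) u∶ refl (TailFiltered-resp tyf≡tyg πf≡πg tail)
        (i , trans (πf≡πg _) πi , ≈-⊒-trans (ss≈ts i (trans (πf≡πg _) πi)) tᵢ⊒u)
    ≈-⊐⊐-trans s≈t@(eq-args f g ss ts s∶ _ refl refl tyf≡tyg _ πf≡πg _)
               (rpo-appl _ ts′ u₀ us _ u∶ e tail refl t⊐⊐u₀ t⊐⊐us)
      with apps-injective fun fun ts ts′ e
    ... | refl , refl =
      rpo-appl f ss u₀ us (_ , s∶) u∶ refl (TailFiltered-resp tyf≡tyg πf≡πg tail) refl
        (≈-⊐⊐-trans s≈t t⊐⊐u₀) (λ i → ≈-⊐⊐-trans s≈t (t⊐⊐us i))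
    ≈-⊐⊐-trans s≈t@(eq-args f g ss ts s∶ _ refl refl tyf≡tyg f≡ₚg πf≡πg _)
               (rpo-copy _ ts′ h us _ u∶ e tail refl g▷h t⊐⊐us)
      with apps-injective fun fun ts ts′ e
    ... | refl , refl =
      rpo-copy f ss h us (_ , s∶) u∶ refl (TailFiltered-resp tyf≡tyg πf≡πg tail) refl
        (≡ₚ-▷-trans f≡ₚg g▷h) (λ i πi → ≈-⊐⊐-trans s≈t (t⊐⊐us i πi))
    ≈-⊐⊐-trans s≈t@(eq-args f g ss ts s∶ _ refl refl tyf≡tyg f≡ₚg πf≡πg ss≈ts)
               (rpo-lex _ ts′ h us _ u∶ e tail refl g≡ₚh
                  i i′ i≡i′ πi πi′ πg≡πh ts≈us tᵢ⊐uᵢ t⊐⊐us)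
      with apps-injective fun fun ts ts′ e
    ... | refl , refl =
      rpo-lex f ss h us (_ , s∶) u∶ refl (TailFiltered-resp tyf≡tyg πf≡πg tail) refl
        (≡ₚ-trans f≡ₚg g≡ₚh)
        i i′ i≡i′ (trans (πf≡πg _) πi) πi′ (λ j j≤ → trans (πf≡πg j) (πg≡πh j j≤))
        (λ j j′ j≡j′ j<i πj → ≈-trans (ss≈ts j πj) (ts≈us j j′ j≡j′ j<i (trans (sym (πf≡πg _)) πj)))
        (≈-⊐-trans (ss≈ts i (trans (πf≡πg _) πi)) tᵢ⊐uᵢ)
        (λ j i<j πj → ≈-⊐⊐-trans s≈t (t⊐⊐us j i<j πj))

  ≈-terminating : s ≈ t → Terminating s → Terminating t
  ≈-terminating s≈t (acc s↓) = acc λ t⊐u → s↓ (≈-⊐-trans s≈t t⊐u)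

  ⊒-terminating : s ⊒ t → Terminating s → Terminating t
  ⊒-terminating (⊒-≈ s≈t) = ≈-terminating s≈t
  ⊒-terminating (⊒-⊐ s⊐t) (acc s↓) = s↓ s⊐t

  ⊐-∶ : s ⊐ t → s ∶ σ → t ∶ σ
  ⊐-∶ (gr-mono _ _ s∶ t∶ _ _ _ _)         s∶′ rewrite ∶-unique s∶′ s∶ = t∶
  ⊐-∶ (gr-args _ _ _ _ s∶ t∶ _ _ _ _ _ _ _) s∶′ rewrite ∶-unique s∶′ s∶ = t∶
  ⊐-∶ (gr-rpo s∶ t∶ _)                    s∶′ rewrite ∶-unique s∶′ s∶ = t∶

  ⊒-∶ : s ⊒ t → s ∶ σ → t ∶ σ
  ⊒-∶ (⊒-≈ s≈t) = ≈-∶ s≈t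
  ⊒-∶ (⊒-⊐ s⊐t) = ⊐-∶ s⊐t

  inπ-inject₁ : ∀ {i : Fin n} → inπ f i → inπ f (inject₁ i)
  inπ-inject₁ {f = f} {i = i} = subst (λ p → π f (suc p) ≡ true) (sym (toℕ-inject₁ i))

  extend-⊐⊐ : s ⊐⊐ t → (s · u) ∶ σ → (s · u) ⊐⊐ t
  extend-⊐⊐ {u = u} (rpo-select f ss _ t∶ refl tail (i , πi , sᵢ⊒t)) d =
    rpo-select f (ss ∷ʳ u) (_ , d) t∶ (sym (apps-∷ʳ _ ss u)) (TailFiltered-suc tail)
      (inject₁ i , inπ-inject₁ πi , subst (_⊒ _) (sym (lookup-∷ʳ-inject₁ ss u i)) sᵢ⊒t)
  extend-⊐⊐ {u = u} (rpo-appl f ss t₀ ts _ t∶ refl tail e s⊐⊐t₀ s⊐⊐ts) d =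
    rpo-appl f (ss ∷ʳ u) t₀ ts (_ , d) t∶ (sym (apps-∷ʳ _ ss u)) (TailFiltered-suc tail) e
      (extend-⊐⊐ s⊐⊐t₀ d) (λ i → extend-⊐⊐ (s⊐⊐ts i) d)
  extend-⊐⊐ {u = u} (rpo-copy f ss g ts _ t∶ refl tail e f▷g s⊐⊐ts) d =
    rpo-copy f (ss ∷ʳ u) g ts (_ , d) t∶ (sym (apps-∷ʳ _ ss u)) (TailFiltered-suc tail) e f▷g
      (λ i πi → extend-⊐⊐ (s⊐⊐ts i πi) d)
  extend-⊐⊐ {u = u}
    (rpo-lex f ss g ts _ t∶ refl tail e f≡ₚg i i′ i≡i′ πi πi′ πf≡πg ss≈ts sᵢ⊐tᵢ s⊐⊐ts) d =
    rpo-lex f (ss ∷ʳ u) g ts (_ , d) t∶ (sym (apps-∷ʳ _ ss u)) (TailFiltered-suc tail) e f≡ₚg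
      (inject₁ i) i′ (trans (toℕ-inject₁ i) i≡i′) (inπ-inject₁ πi) πi′
      (λ j j≤ → πf≡πg j (subst (λ p → j ≤ suc p) (toℕ-inject₁ i) j≤))
      (λ j j′ j≡j′ j<i πj → ∷ʳ-prefix {P = EquivTo} ss u i
         (λ j j<i j′ j≡j′ πj → ss≈ts j j′ j≡j′ j<i πj) j j<i j′ j≡j′ πj)
      (subst (_⊐ _) (sym (lookup-∷ʳ-inject₁ ss u i)) sᵢ⊐tᵢ)
      (λ j i<j πj → extend-⊐⊐ (s⊐⊐ts j i<j πj) d)
    where
    EquivTo : ℕ → Tm → Set
    EquivTo p s = ∀ j′ → p ≡ toℕ j′ → π f (suc p) ≡ true → s ≈ lookup ts j′

  ·-monoˡ-⊐ : s ⊐ t → (s · u) ∶ σ → (s · u) ⊐ (t · u)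
  ·-monoˡ-⊐ {u = u} (gr-mono ss ts s∶ t∶ refl refl ss⊒ts (i , sᵢ⊐tᵢ)) d@(ty-app s∶′ u∶)
    rewrite ∶-unique s∶ s∶′ =
    gr-mono (ss ∷ʳ u) (ts ∷ʳ u) d (ty-app t∶ u∶) (sym (apps-∷ʳ _ ss u)) (sym (apps-∷ʳ _ ts u))
      (∷ʳ-pointwise _⊒_ ss ts u ss⊒ts (⊒-≈ (≈-refl u∶)))
      (inject₁ i , subst₂ _⊐_ (sym (lookup-∷ʳ-inject₁ ss u i)) (sym (lookup-∷ʳ-inject₁ ts u i)) sᵢ⊐tᵢ)
  ·-monoˡ-⊐ {u = u} (gr-args f g ss ts s∶ t∶ refl refl tyf≡tyg f≡ₚg πf≡πg ss⊒ts (i , πi , sᵢ⊐tᵢ))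
    d@(ty-app s∶′ u∶) rewrite ∶-unique s∶ s∶′ =
    gr-args f g (ss ∷ʳ u) (ts ∷ʳ u) d (ty-app t∶ u∶) (sym (apps-∷ʳ _ ss u)) (sym (apps-∷ʳ _ ts u))
      tyf≡tyg f≡ₚg πf≡πg
      (∷ʳ-pointwise-on _⊒_ {λ p → π f (suc p) ≡ true} ss ts u ss⊒ts (λ _ → ⊒-≈ (≈-refl u∶)))
      (inject₁ i , inπ-inject₁ πi ,
       subst₂ _⊐_ (sym (lookup-∷ʳ-inject₁ ss u i)) (sym (lookup-∷ʳ-inject₁ ts u i)) sᵢ⊐tᵢ)
  ·-monoˡ-⊐ {u = u} (gr-rpo s∶ t∶ s⊐⊐t) d@(ty-app s∶′ u∶) with ⊐⊐-fun-head s⊐⊐t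
  ... | f , n , ss , refl , tail rewrite ∶-unique s∶ s∶′ =
    gr-rpo d (ty-app t∶ u∶)
      (rpo-appl f (ss ∷ʳ u) _ (u ∷ []) (_ , d) (_ , ty-app t∶ u∶) (sym (apps-∷ʳ _ ss u))
        (TailFiltered-suc tail) refl (extend-⊐⊐ s⊐⊐t d) λ { zero → su⊐⊐u })
    where
    πₙ : inπ f (fromℕ n)
    πₙ rewrite toℕ-fromℕ n = tail (suc n) (n<1+n n) (fun-apps-⇒-arity ss s∶′)
    su⊐⊐u : (apps (fun f) ss · u) ⊐⊐ u
    su⊐⊐u = rpo-select f (ss ∷ʳ u) (_ , d) (_ , u∶) (sym (apps-∷ʳ _ ss u)) (TailFiltered-suc tail)
              (fromℕ n , πₙ , subst (_⊒ u) (sym (lookup-∷ʳ-fromℕ ss u)) (⊒-≈ (≈-refl u∶)))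

  ·-monoˡ-⊒ : s ⊒ t → (s · u) ∶ σ → (s · u) ⊒ (t · u)
  ·-monoˡ-⊒ (⊒-≈ s≈t) d@(ty-app _ u∶) = ⊒-≈ (·-congˡ-≈ s≈t (≈-refl u∶) d)
  ·-monoˡ-⊒ (⊒-⊐ s⊐t) d              = ⊒-⊐ (·-monoˡ-⊐ s⊐t d)

  ·-terminatingˡ : Terminating (s · u) → (s · u) ∶ σ → Terminating s
  ·-terminatingˡ (acc su↓) d@(ty-app s∶ u∶) =
    acc λ s⊐t → ·-terminatingˡ (su↓ (·-monoˡ-⊐ s⊐t d)) (ty-app (⊐-∶ s⊐t s∶) u∶)

  ⊒⇒≈⊎⊐ : s ⊒ t → s ≈ t ⊎ s ⊐ t
  ⊒⇒≈⊎⊐ (⊒-≈ s≈t) = inj₁ s≈t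
  ⊒⇒≈⊎⊐ (⊒-⊐ s⊐t) = inj₂ s⊐t

  blank : Tm
  blank = var ι 0

  blank-≈ : blank ≈ blank
  blank-≈ = ≈-refl ty-var

  blank-terminating : Terminating blank
  blank-terminating = acc λ blank⊐t → ⊥-elim (blank-irreducible blank⊐t)
    where
    blank-irreducible : ¬ (blank ⊐ t)
    blank-irreducible (gr-mono ss _ _ _ e _ _ (i , _)) with apps-injective var var [] ss e
    ... | refl , refl with i
    ... | ()
    blank-irreducible (gr-args _ _ ss _ _ _ e _ _ _ _ _ _) = var≢fun [] ss e
    blank-irreducible (gr-rpo _ _ blank⊐⊐t)                = ⊐⊐-var-head [] blank⊐⊐t

  Arg : Set
  Arg = Σ Tm Terminating

  -- Oriented as Lex-< expects: x ≺ᵃ y when y ⊐ x, so lexicographic descent follows ⊐.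
  _≺ᵃ_ _≈ᵃ_ : Arg → Arg → Set
  x ≺ᵃ y = proj₁ y ⊐ proj₁ x
  x ≈ᵃ y = proj₁ y ≈ proj₁ x

  ≺ᵃ-wellFounded : WellFounded _≺ᵃ_
  ≺ᵃ-wellFounded (_ , s↓) = acc-≺ᵃ s↓
    where
    acc-≺ᵃ : Terminating s → ∀ {s↓} → Acc _≺ᵃ_ (s , s↓)
    acc-≺ᵃ (acc s↓) = acc λ s⊐t → acc-≺ᵃ (s↓ s⊐t)

  _<ᴸ_ : Vec Arg n → Vec Arg n → Set
  _<ᴸ_ = Lex-< _≈ᵃ_ _≺ᵃ_

  <ᴸ-wellFounded : WellFounded (_<ᴸ_ {n})
  <ᴸ-wellFounded = <-wellFounded (λ x≈y y≈z → ≈-trans y≈z x≈y) ≈-⊐-trans ≺ᵃ-wellFounded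

  argAt : (ss : Vec Tm n) → (∀ i → Terminating (lookup ss i)) → ℕ → Arg
  argAt ss ss↓ p =
    lookupOr blank ss p , lookupOr-all Terminating {λ _ → ⊤} ss blank-terminating (λ i _ → ss↓ i) p tt

  argsOf : (ss : Vec Tm n) → (∀ i → Terminating (lookup ss i)) → Vec Arg n
  argsOf ss ss↓ = tabulate (argAt ss ss↓ ∘ toℕ)

  var-apps-terminating : ∀ {ρ x} (ss : Vec Tm n) (ss↓ : ∀ i → Terminating (lookup ss i)) →
                         Acc _<ᴸ_ (argsOf ss ss↓) → Terminating (apps (var ρ x) ss)
  var-apps-terminating {n} {ρ} {x} ss ss↓ (acc rec) = acc step
    where
    step : apps (var ρ x) ss ⊐ t → Terminating t
    step (gr-mono ss′ ts _ _ e refl ss⊒ts (i , sᵢ⊐tᵢ)) with apps-injective var var ss ss′ e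
    ... | refl , refl =
      var-apps-terminating ts ts↓
        (rec (tabulate-Lex-<-pointwise n (argAt ts ts↓) (argAt ss ss↓) ss≈⊐ts (toℕ i) (toℕ<n i) sᵢ⊐tᵢ′))
      where
      ts↓ : ∀ i → Terminating (lookup ts i)
      ts↓ i = ⊒-terminating (ss⊒ts i) (ss↓ i)
      ss≈⊐ts : ∀ p → lookupOr blank ss p ≈ lookupOr blank ts p ⊎ lookupOr blank ss p ⊐ lookupOr blank ts p
      ss≈⊐ts p =
        ⊒⇒≈⊎⊐ (lookupOr-pointwise _⊒_ {λ _ → ⊤} ss ts (⊒-≈ blank-≈) (λ i _ → ss⊒ts i) p tt)
      sᵢ⊐tᵢ′ : lookupOr blank ss (toℕ i) ⊐ lookupOr blank ts (toℕ i)
      sᵢ⊐tᵢ′ = subst₂ _⊐_ (sym (lookupOr-lookup ss i)) (sym (lookupOr-lookup ts i)) sᵢ⊐tᵢ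
    step (gr-args _ _ ss′ _ _ _ e _ _ _ _ _ _) = ⊥-elim (var≢fun ss ss′ e)
    step (gr-rpo _ _ s⊐⊐t)                     = ⊥-elim (⊐⊐-var-head ss s⊐⊐t)

  mutual
    var-apps-computable : ∀ τ {ρ x} (ss : Vec Tm n) → apps (var ρ x) ss ∶ τ →
                          (∀ i → Terminating (lookup ss i)) → Computable τ (apps (var ρ x) ss)
    var-apps-computable ι       ss _ ss↓ = var-apps-terminating ss ss↓ (<ᴸ-wellFounded _)
    var-apps-computable (σ ⇒ τ) ss d ss↓ u u∶ u-comp =
      subst (Computable τ) (apps-∷ʳ _ ss u)
        (var-apps-computable τ (ss ∷ʳ u) (subst (_∶ τ) (sym (apps-∷ʳ _ ss u)) (ty-app d u∶))
          (∷ʳ-pointwise (λ s _ → Terminating s) ss ss u ss↓ (computable⇒terminating σ u∶ u-comp)))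

    computable⇒terminating : ∀ τ → s ∶ τ → Computable τ s → Terminating s
    computable⇒terminating ι       _  s↓     = s↓
    computable⇒terminating (σ ⇒ τ) s∶ s-comp =
      ·-terminatingˡ (computable⇒terminating τ (ty-app s∶ ty-var) (s-comp _ ty-var x-comp)) (ty-app s∶ ty-var)
      where
      x-comp : Computable σ (var σ 0)
      x-comp = var-apps-computable σ [] ty-var λ ()

  ⊒-computable : ∀ τ → s ∶ τ → s ⊒ t → Computable τ s → Computable τ t
  ⊒-computable ι       _  s⊒t s↓ = ⊒-terminating s⊒t s↓
  ⊒-computable (σ ⇒ τ) s∶ s⊒t s-comp u u∶ u-comp =
    ⊒-computable τ (ty-app s∶ u∶) (·-monoˡ-⊒ s⊒t (ty-app s∶ u∶)) (s-comp u u∶ u-comp)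

  ComputableTerm : Tm → Set
  ComputableTerm t = Σ Ty λ σ → t ∶ σ × Computable σ t

  ComputableTerm⇒Computable : ComputableTerm t → t ∶ τ → Computable τ t
  ComputableTerm⇒Computable (_ , t∶ , t-comp) t∶′ rewrite ∶-unique t∶′ t∶ = t-comp

  ComputableTerm⇒terminating : ComputableTerm t → Terminating t
  ComputableTerm⇒terminating (σ , t∶ , t-comp) = computable⇒terminating σ t∶ t-comp

  ComputableTerm-⊒ : ComputableTerm s → s ⊒ t → ComputableTerm t
  ComputableTerm-⊒ (σ , s∶ , s-comp) s⊒t = σ , ⊒-∶ s⊒t s∶ , ⊒-computable σ s∶ s⊒t s-comp

  blank-computable : ComputableTerm blank
  blank-computable = ι , ty-var , var-apps-computable ι [] ty-var λ ()

  apps-computable : (ts : Vec Tm n) → ComputableTerm a → (∀ i → ComputableTerm (lookup ts i)) →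
                    apps a ts ∶ τ → Computable τ (apps a ts)
  apps-computable []       a-comp _      a∶ = ComputableTerm⇒Computable a-comp a∶
  apps-computable {a = a} (t ∷ ts) (_ , a∶ , a-comp) ts-comp d with apps-head-typed (a · t) ts d
  ... | _ , ty-app a∶′ t∶ with ∶-unique a∶ a∶′
  ... | refl =
    apps-computable ts (_ , ty-app a∶ t∶ , a-comp t t∶ (ComputableTerm⇒Computable (ts-comp zero) t∶))
      (ts-comp ∘ suc) d

  computable-intro : ∀ τ → s ∶ τ →
    (∀ (us : Vec Tm (arity τ)) → apps s us ∶ ι → (∀ j → ComputableTerm (lookup us j)) →
       Terminating (apps s us)) →
    Computable τ s
  computable-intro ι       s∶ saturated↓ = saturated↓ [] s∶ λ ()
  computable-intro (σ ⇒ τ) s∶ saturated↓ u u∶ u-comp =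
    computable-intro τ (ty-app s∶ u∶) λ us d us-comp →
      saturated↓ (u ∷ us) d λ { zero → σ , u∶ , u-comp ; (suc j) → us-comp j }

  FilteredComputable : Fun → Vec Tm n → Set
  FilteredComputable h ss = ∀ i → inπ h i → ComputableTerm (lookup ss i)

  fun-apps-computable : (ts : Vec Tm k) → apps (fun h) ts ∶ τ → FilteredComputable h ts →
    (∀ (us : Vec Tm (arity τ)) → apps (fun h) (ts ++ us) ∶ ι → FilteredComputable h (ts ++ us) →
       Terminating (apps (fun h) (ts ++ us))) →
    Computable τ (apps (fun h) ts)
  fun-apps-computable {h = h} {τ = τ} ts d ts-comp saturated↓ =
    computable-intro τ d λ us d′ us-comp →
      subst Terminating (apps-++ (fun h) ts us)
        (saturated↓ us (subst (_∶ ι) (sym (apps-++ (fun h) ts us)) d′)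
          (++-all ComputableTerm {λ p → π h (suc p) ≡ true} ts us ts-comp us-comp))

  filteredArg : Fun → Vec Tm n → ℕ → Tm
  filteredArg h ss p = if π h (suc p) then lookupOr blank ss p else blank

  filteredArg-lookup : ∀ (ss : Vec Tm n) {i} → inπ h i → filteredArg h ss (toℕ i) ≡ lookup ss i
  filteredArg-lookup ss {i} πi rewrite πi = lookupOr-lookup ss i

  filteredArg-++ˡ : ∀ (ts : Vec Tm k) (us : Vec Tm n) {p} → p < k →
                    filteredArg h (ts ++ us) p ≡ filteredArg h ts p
  filteredArg-++ˡ {h = h} ts us {p} p<k = cong (if π h (suc p) then_else blank) (lookupOr-++ˡ ts us p p<k)

  filteredArgᵃ : (h : Fun) (ss : Vec Tm n) → FilteredComputable h ss → ℕ → Arg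
  filteredArgᵃ h ss hs p = filteredArg h ss p , if-all Terminating blank-terminating λ πp →
    lookupOr-all Terminating {λ p → π h (suc p) ≡ true} ss blank-terminating
      (λ i πi → ComputableTerm⇒terminating (hs i πi)) p πp

  -- Padding with the normal form blank up to the bound N on the arities in an ≡ₚ-class lets
  -- heads of different arities be compared position by position.
  measure : (N : ℕ) (h : Fun) (ss : Vec Tm n) → FilteredComputable h ss → Vec Arg N
  measure N h ss hs = tabulate (filteredArgᵃ h ss hs ∘ toℕ)

  measure-<-args : ∀ {N} (ss ts : Vec Tm n) (hs : FilteredComputable g ss) (ht : FilteredComputable h ts) →
    (∀ j → π g j ≡ π h j) → (∀ i → inπ g i → lookup ss i ⊒ lookup ts i) →
    ∀ i → toℕ i < N → inπ g i → lookup ss i ⊐ lookup ts i → measure N h ts ht <ᴸ measure N g ss hs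
  measure-<-args {g = g} {N = N} ss ts hs ht πg≡πh ss⊒ts i i<N πi sᵢ⊐tᵢ =
    tabulate-Lex-<-pointwise N (filteredArgᵃ _ ts ht) (filteredArgᵃ _ ss hs) ss≈⊐ts (toℕ i) i<N
      (subst₂ _⊐_ (sym (filteredArg-lookup ss πi)) (sym (filteredArg-lookup ts (trans (sym (πg≡πh _)) πi)))
        sᵢ⊐tᵢ)
    where
    ss≈⊐ts : ∀ p → filteredArg g ss p ≈ filteredArg _ ts p ⊎ filteredArg g ss p ⊐ filteredArg _ ts p
    ss≈⊐ts p = ⊒⇒≈⊎⊐ (if-rel _⊒_ (πg≡πh (suc p)) (⊒-≈ blank-≈)
      (lookupOr-pointwise _⊒_ {λ p → π g (suc p) ≡ true} ss ts (⊒-≈ blank-≈) ss⊒ts p))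

  EquivBefore : Fun → Fin n → Vec Tm n → Vec Tm k → Set
  EquivBefore g i ss ts = ∀ j j′ → toℕ j ≡ toℕ j′ → toℕ j < toℕ i → inπ g j → lookup ss j ≈ lookup ts j′

  EquivBefore-lookupOr : ∀ {i : Fin n} (ss : Vec Tm n) (ts : Vec Tm k) → EquivBefore g i ss ts →
    ∀ q → q < toℕ i → q < k → π g (suc q) ≡ true → lookupOr blank ss q ≈ lookupOr blank ts q
  EquivBefore-lookupOr {g = g} {i = i} ss ts ss≈ts q q<i q<k πq =
    lookupOr-aligned _≈_ {λ p → p < toℕ i × π g (suc p) ≡ true} ss ts
      (λ j j′ j≡j′ (j<i , πj) → ss≈ts j j′ j≡j′ j<i πj) q (<-trans q<i (toℕ<n i)) q<k (q<i , πq)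

  measure-<-lex : ∀ {N m} (ss : Vec Tm n) (ts : Vec Tm k) (us : Vec Tm m)
    (hs : FilteredComputable g ss) (ht : FilteredComputable h (ts ++ us)) (i : Fin n) (i′ : Fin k) →
    toℕ i < N → toℕ i ≡ toℕ i′ → inπ g i → inπ h i′ → (∀ j → j ≤ suc (toℕ i) → π g j ≡ π h j) →
    EquivBefore g i ss ts → lookup ss i ⊐ lookup ts i′ → measure N h (ts ++ us) ht <ᴸ measure N g ss hs
  measure-<-lex {k = k} {g = g} {h = h} {N = N} ss ts us hs ht i i′ i<N i≡i′ πi πi′ πg≡πh ss≈ts sᵢ⊐tᵢ =
    tabulate-Lex-<-prefix N (filteredArgᵃ h (ts ++ us) ht) (filteredArgᵃ g ss hs) (toℕ i) i<N prefix≈ strict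
    where
    i<k : toℕ i < k
    i<k = subst (_< k) (sym i≡i′) (toℕ<n i′)
    prefix≈ : ∀ q → q < toℕ i → filteredArg g ss q ≈ filteredArg h (ts ++ us) q
    prefix≈ q q<i = subst (filteredArg g ss q ≈_) (sym (filteredArg-++ˡ ts us q<k))
      (if-rel _≈_ (πg≡πh (suc q) (s≤s (<⇒≤ q<i))) blank-≈ (EquivBefore-lookupOr ss ts ss≈ts q q<i q<k))
      where
      q<k = <-trans q<i i<k
    tᵢ≡ : filteredArg h (ts ++ us) (toℕ i) ≡ lookup ts i′
    tᵢ≡ = begin
      filteredArg h (ts ++ us) (toℕ i) ≡⟨ filteredArg-++ˡ ts us i<k ⟩
      filteredArg h ts (toℕ i)         ≡⟨ cong (filteredArg h ts) i≡i′ ⟩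
      filteredArg h ts (toℕ i′)        ≡⟨ filteredArg-lookup ts πi′ ⟩
      lookup ts i′                     ∎
      where open ≡-Reasoning
    strict : filteredArg g ss (toℕ i) ⊐ filteredArg h (ts ++ us) (toℕ i)
    strict = subst₂ _⊐_ (sym (filteredArg-lookup ss πi)) (sym tᵢ≡) sᵢ⊐tᵢ

  EquivBefore-computable : ∀ {i : Fin n} (ss : Vec Tm n) (ts : Vec Tm k) → FilteredComputable g ss →
    (∀ j → j ≤ suc (toℕ i) → π g j ≡ π h j) → EquivBefore g i ss ts →
    ∀ j → toℕ j < toℕ i → inπ h j → ComputableTerm (lookup ts j)
  EquivBefore-computable {g = g} {i = i} ss ts hs πg≡πh ss≈ts j j<i πj =
    subst ComputableTerm (lookupOr-lookup ts j)
      (ComputableTerm-⊒ sⱼ-comp (⊒-≈ (EquivBefore-lookupOr ss ts ss≈ts (toℕ j) j<i (toℕ<n j) πgj)))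
    where
    πgj : π g (suc (toℕ j)) ≡ true
    πgj = trans (πg≡πh _ (s≤s (<⇒≤ j<i))) πj
    sⱼ-comp : ComputableTerm (lookupOr blank ss (toℕ j))
    sⱼ-comp = lookupOr-all ComputableTerm {λ p → π g (suc p) ≡ true} ss blank-computable hs (toℕ j) πgj

  TerminatesOnComputable : Fun → Set
  TerminatesOnComputable h =
    ∀ {n} (ss : Vec Tm n) → apps (fun h) ss ∶ ι → FilteredComputable h ss → Terminating (apps (fun h) ss)

  module _ {f : Fun} (▷-IH : ∀ {h} → f ▷ h → TerminatesOnComputable h) where
    private
      N : ℕ
      N = proj₁ (≡ₚ-bounded f)

      arity≤N : g ≡ₚ f → (ss : Vec Tm n) → apps (fun g) ss ∶ ι → n ≤ N
      arity≤N g≡f ss d = subst (_≤ N) (fun-apps-ι-arity ss d) (proj₂ (≡ₚ-bounded f) _ g≡f)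

    module _ {g n} (ss : Vec Tm n) (g≡f : g ≡ₚ f) (d : apps (fun g) ss ∶ ι) (hs : FilteredComputable g ss)
             (≡ₚ-IH : ∀ {h k} (ts : Vec Tm k) → h ≡ₚ g → apps (fun h) ts ∶ ι → (ht : FilteredComputable h ts) →
                      measure N h ts ht <ᴸ measure N g ss hs → Terminating (apps (fun h) ts)) where
      private
        i<N : (i : Fin n) → toℕ i < N
        i<N i = <-≤-trans (toℕ<n i) (arity≤N g≡f ss d)

      mutual
        rpo-reduct-computable : apps (fun g) ss ⊐⊐ t → t ∶ τ → Computable τ t
        rpo-reduct-computable (rpo-select _ ss′ _ _ e _ (i , πi , sᵢ⊒t)) t∶
          with apps-injective fun fun ss ss′ e
        ... | refl , refl = ComputableTerm⇒Computable (ComputableTerm-⊒ (hs i πi) sᵢ⊒t) t∶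
        rpo-reduct-computable (rpo-appl _ ss′ t₀ ts _ _ e _ refl s⊐⊐t₀ s⊐⊐ts) t∶
          with apps-injective fun fun ss ss′ e
        ... | refl , refl =
          apps-computable ts (rpo-reduct-computableTerm s⊐⊐t₀) (rpo-reduct-computableTerm ∘ s⊐⊐ts) t∶
        rpo-reduct-computable (rpo-copy _ ss′ h ts _ _ e _ refl g▷h s⊐⊐ts) t∶
          with apps-injective fun fun ss ss′ e
        ... | refl , refl =
          fun-apps-computable ts t∶ (λ i πi → rpo-reduct-computableTerm (s⊐⊐ts i πi)) λ us d hu →
            ▷-IH (≡ₚ-▷-trans (≡ₚ-sym g≡f) g▷h) (ts ++ us) d hu
        rpo-reduct-computable
          (rpo-lex _ ss′ h ts _ _ e _ refl g≡h i i′ i≡i′ πi πi′ πg≡πh ss≈ts sᵢ⊐tᵢ s⊐⊐ts) t∶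
          with apps-injective fun fun ss ss′ e
        ... | refl , refl =
          fun-apps-computable ts t∶ ht λ us d hu →
            ≡ₚ-IH (ts ++ us) (≡ₚ-sym g≡h) d hu
              (measure-<-lex ss ts us hs hu i i′ (i<N i) i≡i′ πi πi′ πg≡πh ss≈ts sᵢ⊐tᵢ)
          where
          ht : FilteredComputable h ts
          ht j πj with <-cmp (toℕ j) (toℕ i′)
          ... | tri< j<i′ _ _ =
            EquivBefore-computable ss ts hs πg≡πh ss≈ts j (subst (toℕ j <_) (sym i≡i′) j<i′) πj
          ... | tri≈ _ j≡i′ _ with toℕ-injective j≡i′
          ...   | refl = ComputableTerm-⊒ (hs i πi) (⊒-⊐ sᵢ⊐tᵢ)
          ht j πj | tri> _ _ i′<j = rpo-reduct-computableTerm (s⊐⊐ts j i′<j πj)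

        rpo-reduct-computableTerm : apps (fun g) ss ⊐⊐ t → ComputableTerm t
        rpo-reduct-computableTerm s⊐⊐t with ⊐⊐-typedʳ s⊐⊐t
        ... | τ , t∶ = τ , t∶ , rpo-reduct-computable s⊐⊐t t∶

      reduct-terminating : apps (fun g) ss ⊐ t → Terminating t
      reduct-terminating (gr-mono ss′ _ _ _ e _ _ _) = ⊥-elim (var≢fun ss′ ss (sym e))
      reduct-terminating (gr-args _ h ss′ ts s∶ t∶ e refl _ g≡h πg≡πh ss⊒ts (i , πi , sᵢ⊐tᵢ))
        with apps-injective fun fun ss ss′ e
      ... | refl , refl rewrite ∶-unique s∶ d =
        ≡ₚ-IH ts (≡ₚ-sym g≡h) t∶ ht (measure-<-args ss ts hs ht πg≡πh ss⊒ts i (i<N i) πi sᵢ⊐tᵢ)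
        where
        ht : FilteredComputable h ts
        ht j πj = ComputableTerm-⊒ (hs j πgj) (ss⊒ts j πgj)
          where πgj = trans (πg≡πh _) πj
      reduct-terminating (gr-rpo s∶ t∶ s⊐⊐t) rewrite ∶-unique s∶ d = rpo-reduct-computable s⊐⊐t t∶

    ≡ₚ-terminating : (ss : Vec Tm n) → g ≡ₚ f → apps (fun g) ss ∶ ι → (hs : FilteredComputable g ss) →
                     Acc _<ᴸ_ (measure N g ss hs) → Terminating (apps (fun g) ss)
    ≡ₚ-terminating ss g≡f d hs (acc rec) =
      acc (reduct-terminating ss g≡f d hs λ ts h≡g dt ht lt →
             ≡ₚ-terminating ts (≡ₚ-trans h≡g g≡f) dt ht (rec lt))

  terminates-on-computable : ∀ f → Acc (λ g f → f ▷ g) f → TerminatesOnComputable f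
  terminates-on-computable f (acc rec) ss d hs =
    ≡ₚ-terminating (λ f▷h → terminates-on-computable _ (rec f▷h)) ss ≡ₚ-refl d hs (<ᴸ-wellFounded _)

lemma11 : (S : Setting) → (f : Setting.Fun S) → Theory.ComputableFun S f
lemma11 S f = fun-apps-computable [] ty-fun (λ ()) λ us d hu → terminates-on-computable f (▷-wf f) us d hu
  where
  open Setting S
  open Theory S
  open Computability S
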